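{- There is a unique configuration $\eta\in\Omega$ satisfying $\eta_{\mathrm C(\varepsilon,\varepsilon)}=((\top,\top),\mathsf{sea})$. The projection to $\Omega_\leftrightarrow$ of $\eta$ is the configuration $\eta_{(s,n)}=(s_{>n}\equiv0^{>n},\,s_{<n}\equiv0^{<n})$, and its projection to $\Omega_{\mathsf{sea}}$ is given by the choices $s_{u,\nwarrow}=0^{\mathbb N}$, $s_{u,\nearrow}=1^{\mathbb N}$, $s_{u,\swarrow}=0^{ -\mathbb N}$ and $s_{u,\searrow}=1^{ -\mathbb N}$ (directions of the marked trees above and below sea level), namely we have $\eta_{\mathrm U(u,v,w)}=(*,\nwarrow)$ if $v\in0^+$, $(*,\nearrow)$ if $v\in1^+$, $(*,\uparrow)$ in all remaining cases; $\eta_{\mathrm C(u,v)}=((\top,\top),\mathsf{sea})$; $\eta_{\mathrm D(w,v,u)}=(*,\swarrow)$ if $v\in0^+$, $(*,\searrow)$ if $v\in1^+$, $(*,\downarrow)$ in all remaining cases.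
   Context: $L=\mathbb Z/2\wr\mathbb Z$ with elements $(s,n)$, $s\colon\mathbb Z+\tfrac12\to\mathbb Z/2$ finitely supported, product $(r,m)(s,n)=(t,m+n)$, $t_i=r_i+s_{i-m}$; $a=(0,1)$, $b=(\delta_{1/2},1)$. $s_{>n}$, $s_{<n}$ denote restrictions of $s$ to positions $>n$, $<n$. For words $u,v,w$ over $\{0,1\}$: $\mathrm C(u,v)=(s,0)$ with $u$ at positions $-|u|+\tfrac12,\dots,-\tfrac12$ and $v$ at $\tfrac12,\dots,|v|-\tfrac12$ (so $\mathrm C(\varepsilon,\varepsilon)=1$); $\mathrm U(u,v,w)=(s,|v|)$ with $u$ left of $0$ as before, $v$ at $\tfrac12,\dots,|v|-\tfrac12$, $w$ right of $|v|$; $\mathrm D(w,v,u)=(s,-|v|)$ with $w$ left of $-|v|$, $v$ at $-|v|+\tfrac12,\dots,-\tfrac12$, $u$ at $\tfrac12,\dots$. $*$ denotes an unspecified entry. $\mathbb B=\{\bot,\top\}$. $\Omega_\leftarrow\subseteq\mathbb B^L$: all $\eta$ such that for all $g$, $(\alpha,\beta,\gamma,\delta)=(\eta_g,\eta_{gab^{ -1}},\eta_{ga},\eta_{gb})$ satisfies $\alpha\vee\beta\Rightarrow\gamma\wedge\delta$ and $\gamma\vee\delta\Rightarrow\alpha\ne\beta$. $\Omega_\rightarrow$: the same with left and right exchanged ($\gamma\vee\delta\Rightarrow\alpha\wedge\beta$, $\alpha\vee\beta\Rightarrow\gamma\ne\delta$). $\Omega_\leftrightarrow\subseteq\Omega_\leftarrow\times\Omega_\rightarrow$: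 configurations with $\alpha=(\top,\top)\iff\gamma=(\top,\top)$ in every such tetrahedron. $U=\{\nwarrow,\uparrow,\nearrow\}$, $D=\{\swarrow,\downarrow,\searrow\}$, $A=U\cup\{\mathsf{sea}\}\cup D$ with $\mathsf{sea}$ the "sea level" symbol (Aquarius sign in the paper); $\phi(U)=1,\phi(\mathsf{sea})=0,\phi(D)=-1$. $\Omega_{\mathsf{sea}}\subseteq A^L$: tetrahedra satisfy $\phi(\alpha)=\phi(\beta)$, $\phi(\gamma)=\phi(\delta)$; $\phi(\gamma)-\phi(\alpha)\in\{0,1\}$; $\alpha=\mathsf{sea}\Rightarrow\{\gamma,\delta\}=\{\nwarrow,\nearrow\}$; $\gamma=\mathsf{sea}\Rightarrow\{\alpha,\beta\}=\{\swarrow,\searrow\}$; $\alpha\in U\Rightarrow\beta=\alpha\wedge\{\gamma,\delta\}=\{\uparrow,\alpha\}$; $\gamma\in D\Rightarrow\delta=\gamma\wedge\{\alpha,\beta\}=\{\downarrow,\gamma\}$. $\Omega\subseteq\Omega_\leftrightarrow\times\Omega_{\mathsf{sea}}$: configurations whose tetrahedra additionally satisfy $\alpha=((\top,*),\mathsf{sea})\Rightarrow\gamma=(*,\nwarrow)\wedge\delta=(*,\nearrow)$; $\alpha=((\top,*),\nwarrow)\Rightarrow\gamma=(*,\nwarrow)$; $\alpha=((\top,*),\nearrow)\Rightarrow\delta=(*,\nearrow)$; $\gamma=((*,\top),\mathsf{sea})\Rightarrow\alpha=(*,\swarrow)\wedge\beta=(*,\searrow)$; $\gamma=((*,\top),\swarrow)\Rightarrow\alpha=(*,\swarrow)$;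 $\gamma=((*,\top),\searrow)\Rightarrow\beta=(*,\searrow)$. -}

module Defs where

open import Data.Bool using (Bool; true; false; _∨_; _∧_; _xor_)
open import Data.Integer using (ℤ; _+_; _-_; -_; ∣_∣; +_; +[1+_]; -[1+_]; 0ℤ; 1ℤ; _≤_; _<_)
open import Data.Integer.Properties as ℤP using ()
open import Data.Nat as ℕ using (ℕ)
open import Data.Nat.Properties as ℕP using ()
open import Data.Product using (Σ; ∃; _×_; _,_; proj₁; proj₂)
open import Data.Sum using (_⊎_)
open import Relation.Binary.PropositionalEquality
open import Relation.Nullary using (¬_)

-- The lamplighter group L = ℤ/2 ≀ ℤ.
-- Convention: the integer k : ℤ encodes the half-integer position k + 1/2.
-- Lamp states ℤ/2 are encoded as Bool (false = 0, true = 1, addition = xor).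

FinSupp : (ℤ → Bool) → Set
FinSupp s = ∃ λ (N : ℕ) → ∀ k → N ℕ.≤ ∣ k ∣ → s k ≡ false

record L : Set where
  constructor mkL
  field
    lamps : ℤ → Bool
    pos   : ℤ
    supp  : FinSupp lamps

open L public

-- equality in L (the support proof is irrelevant)
_≈L_ : L → L → Set
g ≈L h = (∀ k → lamps g k ≡ lamps h k) × pos g ≡ pos h

private
  k≡k-m+m : ∀ k m → k ≡ (k - m) + m
  k≡k-m+m k m = sym (trans (ℤP.+-assoc k (- m) m)
                     (trans (cong (λ x → k + x) (ℤP.+-inverseˡ m)) (ℤP.+-identityʳ k)))

  ff : ∀ {a b} → a ≡ false → b ≡ false → a xor b ≡ false
  ff refl refl = refl

  boundShift : ∀ N k m → N ℕ.+ ∣ m ∣ ℕ.≤ ∣ k ∣ → N ℕ.≤ ∣ k - m ∣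
  boundShift N k m le = ℕP.+-cancelʳ-≤ (∣ m ∣) N (∣ k - m ∣)
    (ℕP.≤-trans le (subst (λ x → ∣ x ∣ ℕ.≤ ∣ k - m ∣ ℕ.+ ∣ m ∣)
                          (sym (k≡k-m+m k m)) (ℤP.∣i+j∣≤∣i∣+∣j∣ (k - m) m)))

_·_ : L → L → L
mkL r m (Nr , pr) · mkL s n (Ns , ps) =
  mkL (λ k → r k xor s (k - m)) (m + n) (Nr ℕ.+ Ns ℕ.+ ∣ m ∣ , pf)
  where
  pf : ∀ k → Nr ℕ.+ Ns ℕ.+ ∣ m ∣ ℕ.≤ ∣ k ∣ → r k xor s (k - m) ≡ false
  pf k le = ff (pr k (ℕP.m+n≤o⇒m≤o Nr (ℕP.≤-trans (ℕP.≤-reflexive (sym (ℕP.+-assoc Nr Ns (∣ m ∣)))) le)))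
               (ps (k - m) (boundShift Ns k m (ℕP.m+n≤o⇒n≤o Nr
                  (ℕP.≤-trans (ℕP.≤-reflexive (sym (ℕP.+-assoc Nr Ns (∣ m ∣)))) le))))

_⁻¹ : L → L
mkL s n (N , p) ⁻¹ = mkL (λ k → s (k + n)) (- n) (N ℕ.+ ∣ n ∣ , pf)
  where
  pf : ∀ k → N ℕ.+ ∣ n ∣ ℕ.≤ ∣ k ∣ → s (k + n) ≡ false
  pf k le = p (k + n) (subst (λ x → N ℕ.≤ ∣ x ∣)
                  (cong (λ x → k + x) (ℤP.neg-involutive n))
                  (boundShift N k (- n) (subst (λ x → N ℕ.+ x ℕ.≤ ∣ k ∣) (sym (ℤP.∣-i∣≡∣i∣ n)) le)))

δ½ : ℤ → Bool
δ½ (+ 0) = true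
δ½ _     = false

-- identity 1 = C(ε,ε), a = (0,1), b = (δ_{1/2},1)
𝟙 : L
𝟙 = mkL (λ _ → false) 0ℤ (0 , λ _ _ → refl)

a : L
a = mkL (λ _ → false) 1ℤ (0 , λ _ _ → refl)

b : L
b = mkL δ½ 1ℤ (1 , pf)
  where
  pf : ∀ k → 1 ℕ.≤ ∣ k ∣ → δ½ k ≡ false
  pf (+ 0) ()
  pf +[1+ n ] _ = refl
  pf -[1+ n ] _ = refl

Respects : {X : Set} → (L → X) → Set
Respects η = ∀ g h → g ≈L h → η g ≡ η h

record Tet (X : Set) : Set where
  constructor tet
  field α β γ δ : X

open Tet public

tetAt : {X : Set} → (L → X) → L → Tet X
tetAt η g = tet (η g) (η ((g · a) · (b ⁻¹))) (η (g · a)) (η (g · b))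

-- 𝔹 = Bool, ⊤ = true, ⊥ = false
LeftRule : Tet Bool → Set
LeftRule (tet α β γ δ) = (α ∨ β ≡ true → γ ∧ δ ≡ true) × (γ ∨ δ ≡ true → α ≢ β)

RightRule : Tet Bool → Set
RightRule (tet α β γ δ) = (γ ∨ δ ≡ true → α ∧ β ≡ true) × (α ∨ β ≡ true → γ ≢ δ)

mapTet : {X Y : Set} → (X → Y) → Tet X → Tet Y
mapTet f (tet α β γ δ) = tet (f α) (f β) (f γ) (f δ)

LRRule : Tet (Bool × Bool) → Set
LRRule (tet α β γ δ) = (α ≡ (true , true) → γ ≡ (true , true))
                     × (γ ≡ (true , true) → α ≡ (true , true))

data A : Set where
  ↖ ↑ ↗ sea ↙ ↓ ↘ : A

φ : A → ℤ
φ ↖ = 1ℤ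
φ ↑ = 1ℤ
φ ↗ = 1ℤ
φ sea = 0ℤ
φ ↙ = - 1ℤ
φ ↓ = - 1ℤ
φ ↘ = - 1ℤ

data InU : A → Set where
  u↖ : InU ↖
  u↑ : InU ↑
  u↗ : InU ↗

data InD : A → Set where
  d↙ : InD ↙
  d↓ : InD ↓
  d↘ : InD ↘

PairIs : A → A → A → A → Set
PairIs x y p q = (x ≡ p × y ≡ q) ⊎ (x ≡ q × y ≡ p)

SeaRule : Tet A → Set
SeaRule (tet α β γ δ) =
    φ α ≡ φ β × φ γ ≡ φ δ
  × (φ γ ≡ φ α ⊎ φ γ ≡ 1ℤ + φ α)
  × (α ≡ sea → PairIs γ δ ↖ ↗)
  × (γ ≡ sea → PairIs α β ↙ ↘)
  × (InU α → β ≡ α × PairIs γ δ ↑ α)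
  × (InD γ → δ ≡ γ × PairIs α β ↓ γ)

Val : Set
Val = (Bool × Bool) × A

CoupleRule : Tet Val → Set
CoupleRule (tet α β γ δ) =
    (proj₁ (proj₁ α) ≡ true → proj₂ α ≡ sea → proj₂ γ ≡ ↖ × proj₂ δ ≡ ↗)
  × (proj₁ (proj₁ α) ≡ true → proj₂ α ≡ ↖ → proj₂ γ ≡ ↖)
  × (proj₁ (proj₁ α) ≡ true → proj₂ α ≡ ↗ → proj₂ δ ≡ ↗)
  × (proj₂ (proj₁ γ) ≡ true → proj₂ γ ≡ sea → proj₂ α ≡ ↙ × proj₂ β ≡ ↘)
  × (proj₂ (proj₁ γ) ≡ true → proj₂ γ ≡ ↙ → proj₂ α ≡ ↙)
  × (proj₂ (proj₁ γ) ≡ true → proj₂ γ ≡ ↘ → proj₂ β ≡ ↘)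

-- η ∈ Ω  (η a function on L, i.e. respecting equality of group elements)
InΩ : (L → Val) → Set
InΩ η = Respects η × (∀ g →
    LeftRule  (mapTet (λ x → proj₁ (proj₁ x)) (tetAt η g))
  × RightRule (mapTet (λ x → proj₂ (proj₁ x)) (tetAt η g))
  × LRRule    (mapTet proj₁ (tetAt η g))
  × SeaRule   (mapTet proj₂ (tetAt η g))
  × CoupleRule (tetAt η g))

-- η_{(s,n)} = (s_{>n} ≡ 0^{>n}, s_{<n} ≡ 0^{<n});  position k+1/2 > n ⇔ n ≤ k
LRFormula : (L → Val) → Set
LRFormula η = ∀ g →
    (proj₁ (proj₁ (η g)) ≡ true → ∀ k → pos g ≤ k → lamps g k ≡ false)
  × ((∀ k → pos g ≤ k → lamps g k ≡ false) → proj₁ (proj₁ (η g)) ≡ true)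
  × (proj₂ (proj₁ (η g)) ≡ true → ∀ k → k < pos g → lamps g k ≡ false)
  × ((∀ k → k < pos g → lamps g k ≡ false) → proj₂ (proj₁ (η g)) ≡ true)

-- g = U(u,v,w) with |v| = n > 0: v is s on positions 1/2 … n-1/2 (k = 0 … n-1);
-- "v ∈ c⁺" means all letters of v equal c (v nonempty since n > 0)
WordU : L → Bool → Set
WordU g c = ∀ k → 0ℤ ≤ k → k < pos g → lamps g k ≡ c

-- g = D(w,v,u) with |v| = -n > 0: v is s on positions n+1/2 … -1/2 (k = n … -1)
WordD : L → Bool → Set
WordD g c = ∀ k → pos g ≤ k → k < 0ℤ → lamps g k ≡ c

SeaFormula : (L → Val) → Set
SeaFormula η = ∀ g →
    (0ℤ < pos g → WordU g false → proj₂ (η g) ≡ ↖)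
  × (0ℤ < pos g → WordU g true  → proj₂ (η g) ≡ ↗)
  × (0ℤ < pos g → ¬ WordU g false → ¬ WordU g true → proj₂ (η g) ≡ ↑)
  × (pos g ≡ 0ℤ → proj₂ (η g) ≡ sea)
  × (pos g < 0ℤ → WordD g false → proj₂ (η g) ≡ ↙)
  × (pos g < 0ℤ → WordD g true  → proj₂ (η g) ≡ ↘)
  × (pos g < 0ℤ → ¬ WordD g false → ¬ WordD g true → proj₂ (η g) ≡ ↓)

-- Write up g = g·a and toggle g = g·a·b⁻¹ (the lamp under the cursor switched), so that the
-- tetrahedron at g is (η g, η (toggle g), η (up g), η (up (toggle g))).  For the lamp layers the left
-- rule reads F (up g) = F g ∨ F (toggle g) with F g and F (toggle g) never both ⊤, and the Ω_↔ rule
-- carries (⊤,⊤) from 𝟙 to every element with all lamps off; an induction on the distance to the end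
-- of the finite support then shows that F g = ⊤ exactly when every lamp at or right of the cursor is
-- off, and dually for G.  On the sea layer, where F g = ⊤ the coupling rules force the two values
-- above η g (↖ and ↗ when leaving sea level, ↑ once the word is mixed), and where the values above
-- lie in U the sea rules force η g itself; below sea level the same holds upside down.  Propagating
-- from 𝟙 along such cleared elements and then filling in the finite support determines the whole
-- sea layer, and the explicit configuration η★, which reads off the shape of the word between sea
-- level and the cursor, satisfies all the rules.
module Submission where

open import Defs
open import Data.Bool as Bool using (Bool; true; false; _∨_; _∧_; _xor_; not)
open import Data.Bool.Properties using (xor-identityʳ; xor-comm; not-involutive; ∨-zeroʳ)
open import Data.Empty using (⊥; ⊥-elim)
open import Data.Integer as ℤ
  using (ℤ; _+_; _-_; -_; +_; +[1+_]; -[1+_]; 0ℤ; 1ℤ; ∣_∣; _≤_; _<_; +≤+; +<+; -≤+; -<+; -≤-)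
import Data.Integer.Properties as ℤP
open import Data.Integer.Tactic.RingSolver using (solve-∀)
open import Data.Nat as ℕ using (ℕ; zero; suc)
import Data.Nat.Properties as ℕP
open import Data.Product using (Σ; _×_; _,_; proj₁; proj₂)
open import Data.Sum using (_⊎_; inj₁; inj₂)
open import Data.Unit using (tt)
open import Function using (_∘_; _⇔_; mk⇔; Equivalence)
open import Relation.Binary.PropositionalEquality
open import Relation.Nullary using (¬_; Dec; yes; no; does)
open import Relation.Nullary.Decidable
  using (map′; _×-dec_; _⊎-dec_; _→-dec_; True; toWitness; does-⇔; dec-true; dec-false)
open import Relation.Binary.Definitions using (tri<; tri≈; tri>)

i<suc[i] : ∀ i → i < ℤ.suc i
i<suc[i] i = ℤP.suc[i]≤j⇒i<j ℤP.≤-refl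

i≤j⇒j≡i⊎suc[i]≤j : ∀ {i j} → i ≤ j → j ≡ i ⊎ ℤ.suc i ≤ j
i≤j⇒j≡i⊎suc[i]≤j {i} {j} i≤j with j ℤP.≟ i
... | yes j≡i = inj₁ j≡i
... | no j≢i = inj₂ (ℤP.i<j⇒suc[i]≤j (ℤP.≤∧≢⇒< i≤j (j≢i ∘ sym)))

i<suc[j]⇒i<j⊎i≡j : ∀ {i j} → i < ℤ.suc j → i < j ⊎ i ≡ j
i<suc[j]⇒i<j⊎i≡j {i} {j} i<sj with i ℤP.≟ j
... | yes i≡j = inj₂ i≡j
... | no i≢j = inj₁ (ℤP.≤∧≢⇒< (subst (i ≤_) (ℤP.pred-suc j) (ℤP.i<j⇒i≤pred[j] i<sj)) i≢j)

i≤+∣i∣ : ∀ i → i ≤ + ∣ i ∣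
i≤+∣i∣ (+ _) = ℤP.≤-refl
i≤+∣i∣ -[1+ _ ] = -≤+

0≤i+∣i∣ : ∀ i → 0ℤ ≤ i + + ∣ i ∣
0≤i+∣i∣ (+ _) = +≤+ ℕ.z≤n
0≤i+∣i∣ -[1+ m ] = ℤP.≤-reflexive (sym (ℤP.n⊖n≡0 (suc m)))

i+N<0⇒N≤∣i∣ : ∀ i {N} → i + + N < 0ℤ → N ℕ.≤ ∣ i ∣
i+N<0⇒N≤∣i∣ (+ _) (+<+ ())
i+N<0⇒N≤∣i∣ -[1+ j ] {N} i+N<0 with N ℕ.≤? suc j
... | yes N≤∣i∣ = N≤∣i∣
... | no N≰∣i∣ = ⊥-elim (ℤP.<⇒≱ i+N<0
      (subst (0ℤ ≤_) (sym (ℤP.⊖-≥ (ℕP.<⇒≤ (ℕP.≰⇒> N≰∣i∣)))) (+≤+ ℕ.z≤n)))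

false≢true : false ≢ true
false≢true ()

does⇒ : ∀ {P : Set} (p : Dec P) → does p ≡ true → P
does⇒ (yes p) _ = p

≡does : ∀ {P : Set} {b} (p : Dec P) → (b ≡ true → P) → (P → b ≡ true) → b ≡ does p
≡does (yes p) _ ⇐ = ⇐ p
≡does {b = false} (no _) _ _ = refl
≡does {b = true} (no ¬p) ⇒ _ = ⊥-elim (¬p (⇒ refl))

both-true⇔ : ∀ {P Q : Set} (p : Dec P) (q : Dec Q) → ((does p , does q) ≡ (true , true)) ⇔ (P × Q)
both-true⇔ p q = mk⇔ (λ eq → does⇒ p (cong proj₁ eq) , does⇒ q (cong proj₂ eq))
                     (λ (p′ , q′) → cong₂ _,_ (dec-true p p′) (dec-true q q′))

-- Moving the cursor and toggling the lamp under it

up down toggle : L → L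
up g = mkL (lamps g) (ℤ.suc (pos g)) (supp g)
down g = mkL (lamps g) (ℤ.pred (pos g)) (supp g)
toggle g = mkL (lamps (g · b)) (pos g) (supp (g · b))

unlit : ℤ → L
unlit n = mkL (λ _ → false) n (0 , λ _ _ → refl)

toggle-here : ∀ g → lamps (toggle g) (pos g) ≡ not (lamps g (pos g))
toggle-here g rewrite ℤP.+-inverseʳ (pos g) = xor-comm (lamps g (pos g)) true

toggle-elsewhere : ∀ g k → k ≢ pos g → lamps (toggle g) k ≡ lamps g k
toggle-elsewhere g k k≢n with k - pos g in eq
... | + zero = ⊥-elim (k≢n (ℤP.i-j≡0⇒i≡j k (pos g) eq))
... | +[1+ _ ] = xor-identityʳ (lamps g k)
... | -[1+ _ ] = xor-identityʳ (lamps g k)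

toggle-below : ∀ g k → k < pos g → lamps (toggle g) k ≡ lamps g k
toggle-below g k k<n = toggle-elsewhere g k (ℤP.<⇒≢ k<n)

toggle-above : ∀ g k → pos g < k → lamps (toggle g) k ≡ lamps g k
toggle-above g k n<k = toggle-elsewhere g k (ℤP.<⇒≢ n<k ∘ sym)

·a≈up : ∀ g → (g · a) ≈L up g
·a≈up g = (λ k → xor-identityʳ (lamps g k)) , ℤP.+-comm (pos g) 1ℤ

·b≈up∘toggle : ∀ g → (g · b) ≈L up (toggle g)
·b≈up∘toggle g = (λ _ → refl) , ℤP.+-comm (pos g) 1ℤ

·ab⁻¹≈toggle : ∀ g → ((g · a) · (b ⁻¹)) ≈L toggle g
·ab⁻¹≈toggle g =
    (λ k → cong₂ (λ x y → x xor δ½ y) (xor-identityʳ (lamps g k)) (shift k (pos g)))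
  , cancel (pos g)
  where
  shift : ∀ k n → (k - (n + 1ℤ)) + 1ℤ ≡ k - n
  shift = solve-∀
  cancel : ∀ n → (n + 1ℤ) + - 1ℤ ≡ n
  cancel = solve-∀

up∘down≈id : ∀ g → up (down g) ≈L g
up∘down≈id g = (λ _ → refl) , ℤP.suc-pred (pos g)

id≈up∘down : ∀ g → g ≈L up (down g)
id≈up∘down g = (λ _ → refl) , sym (ℤP.suc-pred (pos g))

toggle∘toggle≈id : ∀ g → toggle (toggle g) ≈L g
toggle∘toggle≈id g = twice , refl
  where
  twice : ∀ k → lamps (toggle (toggle g)) k ≡ lamps g k
  twice k with k ℤP.≟ pos g
  ... | yes refl = trans (toggle-here (toggle g)) (trans (cong not (toggle-here g)) (not-involutive _))
  ... | no k≢n = trans (toggle-elsewhere (toggle g) k k≢n) (toggle-elsewhere g k k≢n)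

up-≈ : ∀ g h → g ≈L h → up g ≈L up h
up-≈ g h (same , eq) = same , cong ℤ.suc eq

tet-cong : ∀ {X : Set} {α α′ β β′ γ γ′ δ δ′ : X}
         → α ≡ α′ → β ≡ β′ → γ ≡ γ′ → δ ≡ δ′ → tet α β γ δ ≡ tet α′ β′ γ′ δ′
tet-cong refl refl refl refl = refl

tetrahedron : {X : Set} → (L → X) → L → Tet X
tetrahedron η g = tet (η g) (η (toggle g)) (η (up g)) (η (up (toggle g)))

tetAt≡tetrahedron : {X : Set} (η : L → X) → Respects η → ∀ g → tetAt η g ≡ tetrahedron η g
tetAt≡tetrahedron η resp g =
  tet-cong refl (resp _ _ (·ab⁻¹≈toggle g)) (resp _ _ (·a≈up g)) (resp _ _ (·b≈up∘toggle g))

Admissible : Tet Val → Set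
Admissible t = LeftRule (mapTet (λ x → proj₁ (proj₁ x)) t)
             × RightRule (mapTet (λ x → proj₂ (proj₁ x)) t)
             × LRRule (mapTet proj₁ t)
             × SeaRule (mapTet proj₂ t)
             × CoupleRule t

-- Lamps off on one side of the cursor

ClearAbove ClearBelow : L → Set
ClearAbove g = ∀ k → pos g ≤ k → lamps g k ≡ false
ClearBelow g = ∀ k → k < pos g → lamps g k ≡ false

ClearAbove-≈ : ∀ g h → g ≈L h → ClearAbove g → ClearAbove h
ClearAbove-≈ g h (same , refl) clear k n≤k = trans (sym (same k)) (clear k n≤k)

ClearBelow-≈ : ∀ g h → g ≈L h → ClearBelow g → ClearBelow h
ClearBelow-≈ g h (same , refl) clear k k<n = trans (sym (same k)) (clear k k<n)

cursor-off-and-on : ∀ g → lamps g (pos g) ≡ false → lamps (toggle g) (pos g) ≡ false → ⊥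
cursor-off-and-on g off off′
  with subst (λ x → not x ≡ false) off (trans (sym (toggle-here g)) off′)
... | ()

ClearAbove-up : ∀ g → ClearAbove g ⊎ ClearAbove (toggle g) → ClearAbove (up g)
ClearAbove-up g (inj₁ clear) k sn≤k = clear k (ℤP.<⇒≤ (ℤP.suc[i]≤j⇒i<j sn≤k))
ClearAbove-up g (inj₂ clear) k sn≤k =
  trans (sym (toggle-above g k (ℤP.suc[i]≤j⇒i<j sn≤k))) (clear k (ℤP.<⇒≤ (ℤP.suc[i]≤j⇒i<j sn≤k)))

ClearAbove-up∘toggle : ∀ g → ClearAbove (up g) → ClearAbove (up (toggle g))
ClearAbove-up∘toggle g clear k sn≤k = trans (toggle-above g k (ℤP.suc[i]≤j⇒i<j sn≤k)) (clear k sn≤k)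

ClearAbove-up∘untoggle : ∀ g → ClearAbove (up (toggle g)) → ClearAbove (up g)
ClearAbove-up∘untoggle g clear k sn≤k = trans (sym (toggle-above g k (ℤP.suc[i]≤j⇒i<j sn≤k))) (clear k sn≤k)

ClearAbove-down : ∀ g → ClearAbove (up g) → lamps g (pos g) ≡ false → ClearAbove g
ClearAbove-down g clear off k n≤k with i≤j⇒j≡i⊎suc[i]≤j n≤k
... | inj₁ refl = off
... | inj₂ sn≤k = clear k sn≤k

ClearAbove-up⁻¹ : ∀ g → ClearAbove (up g) → ClearAbove g ⊎ ClearAbove (toggle g)
ClearAbove-up⁻¹ g clear with lamps g (pos g) in cursor
... | false = inj₁ (ClearAbove-down g clear cursor)
... | true = inj₂ (ClearAbove-down (toggle g) (ClearAbove-up∘toggle g clear)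
                                  (trans (toggle-here g) (cong not cursor)))

ClearAbove-exclusive : ∀ g → ClearAbove g → ClearAbove (toggle g) → ⊥
ClearAbove-exclusive g clear clear′ = cursor-off-and-on g (clear _ ℤP.≤-refl) (clear′ _ ℤP.≤-refl)

ClearBelow-toggle : ∀ g → ClearBelow g → ClearBelow (toggle g)
ClearBelow-toggle g clear k k<n = trans (toggle-below g k k<n) (clear k k<n)

ClearBelow-untoggle : ∀ g → ClearBelow (toggle g) → ClearBelow g
ClearBelow-untoggle g clear k k<n = trans (sym (toggle-below g k k<n)) (clear k k<n)

ClearBelow-down : ∀ g → ClearBelow (up g) → ClearBelow g
ClearBelow-down g clear k k<n = clear k (ℤP.<-trans k<n (i<suc[i] (pos g)))

ClearBelow-up : ∀ g → ClearBelow g → lamps g (pos g) ≡ false → ClearBelow (up g)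
ClearBelow-up g clear off k k<sn with i<suc[j]⇒i<j⊎i≡j k<sn
... | inj₁ k<n = clear k k<n
... | inj₂ refl = off

ClearBelow-up⁻¹ : ∀ g → ClearBelow g → ClearBelow (up g) ⊎ ClearBelow (up (toggle g))
ClearBelow-up⁻¹ g clear with lamps g (pos g) in cursor
... | false = inj₁ (ClearBelow-up g clear cursor)
... | true = inj₂ (ClearBelow-up (toggle g) (ClearBelow-toggle g clear)
                                (trans (toggle-here g) (cong not cursor)))

ClearBelow-exclusive : ∀ g → ClearBelow (up g) → ClearBelow (up (toggle g)) → ⊥
ClearBelow-exclusive g clear clear′ =
  cursor-off-and-on g (clear _ (i<suc[i] (pos g))) (clear′ _ (i<suc[i] (pos g)))

all-off≈unlit : ∀ g → ClearAbove g → ClearBelow g → g ≈L unlit (pos g)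
all-off≈unlit g clear↑ clear↓ = off , refl
  where
  off : ∀ k → lamps g k ≡ false
  off k with ℤP.<-cmp k (pos g)
  ... | tri< k<n _ _ = clear↓ k k<n
  ... | tri≈ _ refl _ = clear↑ k ℤP.≤-refl
  ... | tri> _ _ n<k = clear↑ k (ℤP.<⇒≤ n<k)

ClearAboveFrom ClearBelowFrom : ℕ → L → Set
ClearAboveFrom d g = ∀ k → pos g + + d ≤ k → lamps g k ≡ false
ClearBelowFrom d g = ∀ k → k + + d < pos g → lamps g k ≡ false

ClearAboveFrom-zero : ∀ g → ClearAboveFrom 0 g → ClearAbove g
ClearAboveFrom-zero g clear k n≤k = clear k (subst (_≤ k) (sym (ℤP.+-identityʳ (pos g))) n≤k)

ClearBelowFrom-zero : ∀ g → ClearBelowFrom 0 g → ClearBelow g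
ClearBelowFrom-zero g clear k k<n = clear k (subst (_< pos g) (sym (ℤP.+-identityʳ k)) k<n)

ClearAboveFrom-up : ∀ d g → ClearAboveFrom (suc d) g → ClearAboveFrom d (up g)
ClearAboveFrom-up d g clear k le = clear k (subst (_≤ k) (shift (pos g) (+ d)) le)
  where
  shift : ∀ i j → (1ℤ + i) + j ≡ i + (1ℤ + j)
  shift = solve-∀

ClearAboveFrom-up∘toggle : ∀ d g → ClearAboveFrom (suc d) g → ClearAboveFrom d (up (toggle g))
ClearAboveFrom-up∘toggle d g clear k le =
  trans (toggle-above g k (ℤP.suc[i]≤j⇒i<j (ℤP.≤-trans (ℤP.i≤i+j _ (+ d)) le)))
        (ClearAboveFrom-up d g clear k le)

ClearBelowFrom-down : ∀ d g → ClearBelowFrom (suc d) g → ClearBelowFrom d (down g)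
ClearBelowFrom-down d g clear k lt =
  clear k (subst (_< pos g) (shift k (+ d)) (ℤP.i≤pred[j]⇒i<j (ℤP.i<j⇒suc[i]≤j lt)))
  where
  shift : ∀ i j → 1ℤ + (i + j) ≡ i + (1ℤ + j)
  shift = solve-∀

ClearBelowFrom-toggle∘down : ∀ d g → ClearBelowFrom (suc d) g → ClearBelowFrom d (toggle (down g))
ClearBelowFrom-toggle∘down d g clear k lt =
  trans (toggle-below (down g) k (ℤP.≤-<-trans (ℤP.i≤i+j k (+ d)) lt)) (ClearBelowFrom-down d g clear k lt)

finite-above : ∀ g → Σ ℕ λ d → ClearAboveFrom d g
finite-above g = N ℕ.+ ∣ n ∣ , λ k le → off k (far k le)
  where
  N = proj₁ (supp g)
  off = proj₂ (supp g)
  n = pos g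
  swap : ∀ i j l → j + (i + l) ≡ i + (j + l)
  swap = solve-∀
  open ℤP.≤-Reasoning
  far : ∀ k → n + + (N ℕ.+ ∣ n ∣) ≤ k → N ℕ.≤ ∣ k ∣
  far k le with begin
      + N                  ≡⟨ sym (ℤP.+-identityʳ (+ N)) ⟩
      + N + 0ℤ             ≤⟨ ℤP.+-monoʳ-≤ (+ N) (0≤i+∣i∣ n) ⟩
      + N + (n + + ∣ n ∣)  ≡⟨ swap n (+ N) (+ ∣ n ∣) ⟩
      n + + (N ℕ.+ ∣ n ∣)  ≤⟨ le ⟩
      k                    ∎
  ... | +≤+ N≤k = N≤k

finite-below : ∀ g → Σ ℕ λ d → ClearBelowFrom d g
finite-below g = N ℕ.+ ∣ n ∣ , λ k lt → off k (far k lt)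
  where
  N = proj₁ (supp g)
  off = proj₂ (supp g)
  n = pos g
  assoc : ∀ i j l → (i + j) + l ≡ i + (j + l)
  assoc = solve-∀
  open ℤP.≤-Reasoning
  far : ∀ k → k + + (N ℕ.+ ∣ n ∣) < n → N ℕ.≤ ∣ k ∣
  far k lt = i+N<0⇒N≤∣i∣ k (ℤP.≰⇒> λ 0≤k+N → ℤP.<⇒≱ lt (begin
      n                    ≤⟨ i≤+∣i∣ n ⟩
      + ∣ n ∣              ≡⟨ sym (ℤP.+-identityˡ (+ ∣ n ∣)) ⟩
      0ℤ + + ∣ n ∣         ≤⟨ ℤP.+-monoˡ-≤ (+ ∣ n ∣) 0≤k+N ⟩
      (k + + N) + + ∣ n ∣  ≡⟨ assoc k (+ N) (+ ∣ n ∣) ⟩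
      k + + (N ℕ.+ ∣ n ∣)  ∎))

ClearAbove? : ∀ g → Dec (ClearAbove g)
ClearAbove? g = decide (proj₁ (finite-above g)) g (proj₂ (finite-above g))
  where
  decide : ∀ d g → ClearAboveFrom d g → Dec (ClearAbove g)
  decide zero g clear = yes (ClearAboveFrom-zero g clear)
  decide (suc d) g clear =
    map′ (λ (off , clear′) → ClearAbove-down g clear′ off)
         (λ clear′ → clear′ _ ℤP.≤-refl , ClearAbove-up g (inj₁ clear′))
         ((lamps g (pos g) Bool.≟ false) ×-dec decide d (up g) (ClearAboveFrom-up d g clear))

ClearBelow? : ∀ g → Dec (ClearBelow g)
ClearBelow? g = decide (proj₁ (finite-below g)) g (proj₂ (finite-below g))
  where
  decide : ∀ d g → ClearBelowFrom d g → Dec (ClearBelow g)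
  decide zero g clear = yes (ClearBelowFrom-zero g clear)
  decide (suc d) g clear =
    map′ (λ (clear′ , off) → ClearBelow-≈ (up h) g (up∘down≈id g) (ClearBelow-up h clear′ off))
         (λ clear′ → let clear↑ = ClearBelow-≈ g (up h) (id≈up∘down g) clear′
                     in ClearBelow-down h clear↑ , clear↑ _ (i<suc[i] (pos h)))
         (decide d h (ClearBelowFrom-down d g clear) ×-dec (lamps h (pos h) Bool.≟ false))
    where
    h = down g

negativePart nonnegativePart : L → L
negativePart g = mkL lamps⁻ 0ℤ (proj₁ (supp g) , off)
  where
  lamps⁻ : ℤ → Bool
  lamps⁻ (+ _) = false
  lamps⁻ -[1+ j ] = lamps g -[1+ j ]
  off : ∀ k → proj₁ (supp g) ℕ.≤ ∣ k ∣ → lamps⁻ k ≡ false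
  off (+ _) _ = refl
  off -[1+ j ] far = proj₂ (supp g) -[1+ j ] far
nonnegativePart g = mkL lamps⁺ 0ℤ (proj₁ (supp g) , off)
  where
  lamps⁺ : ℤ → Bool
  lamps⁺ (+ j) = lamps g (+ j)
  lamps⁺ -[1+ _ ] = false
  off : ∀ k → proj₁ (supp g) ℕ.≤ ∣ k ∣ → lamps⁺ k ≡ false
  off (+ j) far = proj₂ (supp g) (+ j) far
  off -[1+ _ ] _ = refl

leftRule⇔ : ∀ t → LeftRule t ⇔ (γ t ≡ α t ∨ β t × δ t ≡ α t ∨ β t × α t ∧ β t ≡ false)
leftRule⇔ (tet _ _ _ _) = mk⇔ ⇒ ⇐
  where
  ⇒ : ∀ {α β γ δ} → LeftRule (tet α β γ δ) → γ ≡ α ∨ β × δ ≡ α ∨ β × α ∧ β ≡ false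
  ⇒ {false} {false} {false} {false} _ = refl , refl , refl
  ⇒ {false} {false} {true} (_ , distinct) = ⊥-elim (distinct refl refl)
  ⇒ {false} {false} {false} {true} (_ , distinct) = ⊥-elim (distinct refl refl)
  ⇒ {true} {false} {true} {true} _ = refl , refl , refl
  ⇒ {true} {false} {false} (lit , _) = ⊥-elim (false≢true (lit refl))
  ⇒ {true} {false} {true} {false} (lit , _) = ⊥-elim (false≢true (lit refl))
  ⇒ {false} {true} {true} {true} _ = refl , refl , refl
  ⇒ {false} {true} {false} (lit , _) = ⊥-elim (false≢true (lit refl))
  ⇒ {false} {true} {true} {false} (lit , _) = ⊥-elim (false≢true (lit refl))
  ⇒ {true} {true} {true} {true} (_ , distinct) = ⊥-elim (distinct refl refl)
  ⇒ {true} {true} {false} (lit , _) = ⊥-elim (false≢true (lit refl))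
  ⇒ {true} {true} {true} {false} (lit , _) = ⊥-elim (false≢true (lit refl))
  ⇐ : ∀ {α β γ δ} → γ ≡ α ∨ β × δ ≡ α ∨ β × α ∧ β ≡ false → LeftRule (tet α β γ δ)
  ⇐ {false} {false} (refl , refl , _) = (λ ()) , (λ ())
  ⇐ {true} {false} (refl , refl , _) = (λ _ → refl) , (λ _ ())
  ⇐ {false} {true} (refl , refl , _) = (λ _ → refl) , (λ _ ())
  ⇐ {true} {true} (_ , _ , ())

rightRule⇔ : ∀ t → RightRule t ⇔ (α t ≡ γ t ∨ δ t × β t ≡ γ t ∨ δ t × γ t ∧ δ t ≡ false)
rightRule⇔ (tet _ _ _ _) = mk⇔ ⇒ ⇐
  where
  ⇒ : ∀ {α β γ δ} → RightRule (tet α β γ δ) → α ≡ γ ∨ δ × β ≡ γ ∨ δ × γ ∧ δ ≡ false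
  ⇒ {false} {false} {false} {false} _ = refl , refl , refl
  ⇒ {true} {_} {false} {false} (_ , distinct) = ⊥-elim (distinct refl refl)
  ⇒ {false} {true} {false} {false} (_ , distinct) = ⊥-elim (distinct refl refl)
  ⇒ {true} {true} {true} {false} _ = refl , refl , refl
  ⇒ {false} {_} {true} {false} (lit , _) = ⊥-elim (false≢true (lit refl))
  ⇒ {true} {false} {true} {false} (lit , _) = ⊥-elim (false≢true (lit refl))
  ⇒ {true} {true} {false} {true} _ = refl , refl , refl
  ⇒ {false} {_} {false} {true} (lit , _) = ⊥-elim (false≢true (lit refl))
  ⇒ {true} {false} {false} {true} (lit , _) = ⊥-elim (false≢true (lit refl))
  ⇒ {true} {true} {true} {true} (_ , distinct) = ⊥-elim (distinct refl refl)
  ⇒ {false} {_} {true} {true} (lit , _) = ⊥-elim (false≢true (lit refl))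
  ⇒ {true} {false} {true} {true} (lit , _) = ⊥-elim (false≢true (lit refl))
  ⇐ : ∀ {α β γ δ} → α ≡ γ ∨ δ × β ≡ γ ∨ δ × γ ∧ δ ≡ false → RightRule (tet α β γ δ)
  ⇐ {γ = false} {false} (refl , refl , _) = (λ ()) , (λ ())
  ⇐ {γ = true} {false} (refl , refl , _) = (λ _ → refl) , (λ _ ())
  ⇐ {γ = false} {true} (refl , refl , _) = (λ _ → refl) , (λ _ ())
  ⇐ {γ = true} {true} (_ , _ , ())

-- Shapes of words

data Shape : Set where
  empty zeros ones mixed : Shape

snoc : Shape → Bool → Shape
snoc empty false = zeros
snoc empty true = ones
snoc zeros false = zeros
snoc ones true = ones
snoc _ _ = mixed

shape : (ℕ → Bool) → ℕ → Shape
shape f zero = empty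
shape f (suc m) = snoc (shape f m) (f m)

shape-ext : ∀ f f′ m → (∀ j → j ℕ.< m → f j ≡ f′ j) → shape f m ≡ shape f′ m
shape-ext f f′ zero _ = refl
shape-ext f f′ (suc m) same = cong₂ snoc (shape-ext f f′ m (λ j j<m → same j (ℕP.m<n⇒m<1+n j<m)))
                                         (same m ℕP.≤-refl)

constant : Bool → Shape
constant false = zeros
constant true = ones

aboveSea belowSea : Shape → A
aboveSea empty = sea
aboveSea zeros = ↖
aboveSea ones = ↗
aboveSea mixed = ↑
belowSea empty = sea
belowSea zeros = ↙
belowSea ones = ↘
belowSea mixed = ↓

-- The word v of U(u,v,w), resp. D(w,v,u), consists of the lamps between sea level and the cursor.
seaLevel : (ℤ → Bool) → ℤ → A
seaLevel s (+ m) = aboveSea (shape (λ j → s (+ j)) m)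
seaLevel s -[1+ m ] = belowSea (shape (λ j → s -[1+ j ]) (suc m))

tetAbove tetBelow : Shape → Bool → Tet A
tetAbove w x = tet (aboveSea w) (aboveSea w) (aboveSea (snoc w x)) (aboveSea (snoc w (not x)))
tetBelow w x = tet (belowSea (snoc w x)) (belowSea (snoc w (not x))) (belowSea w) (belowSea w)

aboveSea-snoc : ∀ w x → InU (aboveSea (snoc w x))
aboveSea-snoc empty false = u↖
aboveSea-snoc empty true = u↗
aboveSea-snoc zeros false = u↖
aboveSea-snoc zeros true = u↑
aboveSea-snoc ones false = u↑
aboveSea-snoc ones true = u↗
aboveSea-snoc mixed _ = u↑

belowSea-snoc : ∀ w x → InD (belowSea (snoc w x))
belowSea-snoc empty false = d↙
belowSea-snoc empty true = d↘
belowSea-snoc zeros false = d↙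
belowSea-snoc zeros true = d↓
belowSea-snoc ones false = d↓
belowSea-snoc ones true = d↘
belowSea-snoc mixed _ = d↓

snoc-nonempty : ∀ w x → snoc w x ≢ empty
snoc-nonempty w x empty≡ with subst (InU ∘ aboveSea) empty≡ (aboveSea-snoc w x)
... | ()

snoc-constant⁻¹ : ∀ w x c → snoc w x ≡ constant c → x ≡ c × (w ≡ empty ⊎ w ≡ constant c)
snoc-constant⁻¹ empty false false _ = refl , inj₁ refl
snoc-constant⁻¹ empty true true _ = refl , inj₁ refl
snoc-constant⁻¹ zeros false false _ = refl , inj₂ refl
snoc-constant⁻¹ ones true true _ = refl , inj₂ refl
snoc-constant⁻¹ empty false true ()
snoc-constant⁻¹ empty true false ()
snoc-constant⁻¹ zeros false true ()
snoc-constant⁻¹ zeros true false ()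
snoc-constant⁻¹ zeros true true ()
snoc-constant⁻¹ ones false false ()
snoc-constant⁻¹ ones false true ()
snoc-constant⁻¹ ones true false ()
snoc-constant⁻¹ mixed _ false ()
snoc-constant⁻¹ mixed _ true ()

shape-constant : ∀ f m c → (∀ j → j ℕ.< suc m → f j ≡ c) → shape f (suc m) ≡ constant c
shape-constant f zero c same = trans (cong (snoc empty) (same 0 ℕP.≤-refl)) (first c)
  where
  first : ∀ c → snoc empty c ≡ constant c
  first false = refl
  first true = refl
shape-constant f (suc m) c same =
  trans (cong₂ snoc (shape-constant f m c (λ j j<sm → same j (ℕP.m<n⇒m<1+n j<sm))) (same (suc m) ℕP.≤-refl))
        (again c)
  where
  again : ∀ c → snoc (constant c) c ≡ constant c
  again false = refl
  again true = refl

shape-constant⁻¹ : ∀ f m c → shape f m ≡ constant c → ∀ j → j ℕ.< m → f j ≡ c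
shape-constant⁻¹ f (suc m) c same j j<sm
  with snoc-constant⁻¹ (shape f m) (f m) c same | ℕP.m≤n⇒m<n∨m≡n (ℕP.≤-pred j<sm)
... | last≡c , _ | inj₂ refl = last≡c
... | _ , inj₂ init≡c | inj₁ j<m = shape-constant⁻¹ f m c init≡c j j<m
shape-constant⁻¹ f (suc (suc m)) c same j j<sm | _ , inj₁ init≡empty | inj₁ _ =
  ⊥-elim (snoc-nonempty _ _ init≡empty)

shape-mixed : ∀ f m → (∀ c → ¬ (∀ j → j ℕ.< suc m → f j ≡ c)) → shape f (suc m) ≡ mixed
shape-mixed f m nonconstant with shape f (suc m) in eq
... | empty = ⊥-elim (snoc-nonempty _ _ eq)
... | zeros = ⊥-elim (nonconstant false (shape-constant⁻¹ f (suc m) false eq))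
... | ones = ⊥-elim (nonconstant true (shape-constant⁻¹ f (suc m) true eq))
... | mixed = refl

-- The sea rules

index : A → ℕ
index ↖ = 0
index ↑ = 1
index ↗ = 2
index sea = 3
index ↙ = 4
index ↓ = 5
index ↘ = 6

index-injective : ∀ {x y} → index x ≡ index y → x ≡ y
index-injective {x} {y} eq = trans (sym (left-inverse x)) (trans (cong fromIndex eq) (left-inverse y))
  where
  fromIndex : ℕ → A
  fromIndex 0 = ↖
  fromIndex 1 = ↑
  fromIndex 2 = ↗
  fromIndex 3 = sea
  fromIndex 4 = ↙
  fromIndex 5 = ↓
  fromIndex _ = ↘
  left-inverse : ∀ x → fromIndex (index x) ≡ x
  left-inverse ↖ = refl
  left-inverse ↑ = refl
  left-inverse ↗ = refl
  left-inverse sea = refl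
  left-inverse ↙ = refl
  left-inverse ↓ = refl
  left-inverse ↘ = refl

_≟A_ : (x y : A) → Dec (x ≡ y)
x ≟A y = map′ index-injective (cong index) (index x ℕ.≟ index y)

InU? : ∀ x → Dec (InU x)
InU? ↖ = yes u↖
InU? ↑ = yes u↑
InU? ↗ = yes u↗
InU? sea = no λ ()
InU? ↙ = no λ ()
InU? ↓ = no λ ()
InU? ↘ = no λ ()

InD? : ∀ x → Dec (InD x)
InD? ↙ = yes d↙
InD? ↓ = yes d↓
InD? ↘ = yes d↘
InD? ↖ = no λ ()
InD? ↑ = no λ ()
InD? ↗ = no λ ()
InD? sea = no λ ()

PairIs? : ∀ x y p q → Dec (PairIs x y p q)
PairIs? x y p q = ((x ≟A p) ×-dec (y ≟A q)) ⊎-dec ((x ≟A q) ×-dec (y ≟A p))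

SeaRule? : ∀ t → Dec (SeaRule t)
SeaRule? (tet α β γ δ) =
      (φ α ℤ.≟ φ β)
  ×-dec (φ γ ℤ.≟ φ δ)
  ×-dec ((φ γ ℤ.≟ φ α) ⊎-dec (φ γ ℤ.≟ 1ℤ + φ α))
  ×-dec ((α ≟A sea) →-dec PairIs? γ δ ↖ ↗)
  ×-dec ((γ ≟A sea) →-dec PairIs? α β ↙ ↘)
  ×-dec (InU? α →-dec ((β ≟A α) ×-dec PairIs? γ δ ↑ α))
  ×-dec (InD? γ →-dec ((δ ≟A γ) ×-dec PairIs? α β ↓ γ))

seaRule-above : ∀ w x → SeaRule (tetAbove w x)
seaRule-above w x = toWitness (decided w x)
  where
  decided : ∀ w x → True (SeaRule? (tetAbove w x))
  decided empty false = tt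
  decided empty true = tt
  decided zeros false = tt
  decided zeros true = tt
  decided ones false = tt
  decided ones true = tt
  decided mixed false = tt
  decided mixed true = tt

seaRule-below : ∀ w x → SeaRule (tetBelow w x)
seaRule-below w x = toWitness (decided w x)
  where
  decided : ∀ w x → True (SeaRule? (tetBelow w x))
  decided empty false = tt
  decided empty true = tt
  decided zeros false = tt
  decided zeros true = tt
  decided ones false = tt
  decided ones true = tt
  decided mixed false = tt
  decided mixed true = tt

data Side : A → Set where
  in-U : ∀ {x} → InU x → Side x
  is-sea : Side sea
  in-D : ∀ {x} → InD x → Side x

side : ∀ x → Side x
side ↖ = in-U u↖
side ↑ = in-U u↑
side ↗ = in-U u↗
side sea = is-sea
side ↙ = in-D d↙
side ↓ = in-D d↓
side ↘ = in-D d↘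

φ-U : ∀ {x} → InU x → φ x ≡ 1ℤ
φ-U u↖ = refl
φ-U u↑ = refl
φ-U u↗ = refl

φ-D : ∀ {x} → InD x → φ x ≡ - 1ℤ
φ-D d↙ = refl
φ-D d↓ = refl
φ-D d↘ = refl

no-descent : ∀ {α γ} → InU γ → InD α → ¬ (φ γ ≡ φ α ⊎ φ γ ≡ 1ℤ + φ α)
no-descent uγ dα (inj₁ rise) with trans (sym (φ-U uγ)) (trans rise (φ-D dα))
... | ()
no-descent uγ dα (inj₂ rise) with trans (sym (φ-U uγ)) (trans rise (cong (λ x → 1ℤ + x) (φ-D dα)))
... | ()

bottomOf topOf : A → A → A
bottomOf ↖ ↗ = sea
bottomOf ↗ ↖ = sea
bottomOf ↑ y = y
bottomOf x _ = x
topOf ↙ ↘ = sea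
topOf ↘ ↙ = sea
topOf ↓ y = y
topOf x _ = x

bottomOf-U : ∀ {x} → InU x → bottomOf x ↑ ≡ x
bottomOf-U u↖ = refl
bottomOf-U u↑ = refl
bottomOf-U u↗ = refl

topOf-D : ∀ {x} → InD x → topOf x ↓ ≡ x
topOf-D d↙ = refl
topOf-D d↓ = refl
topOf-D d↘ = refl

α≡bottomOf : ∀ {α β γ δ} → SeaRule (tet α β γ δ) → InU γ → α ≡ bottomOf γ δ
α≡bottomOf {α} (_ , _ , rise , α-sea , _ , α-U , _) uγ with side α
... | is-sea with α-sea refl
...   | inj₁ (refl , refl) = refl
...   | inj₂ (refl , refl) = refl
α≡bottomOf (_ , _ , _ , _ , _ , α-U , _) uγ | in-U uα with proj₂ (α-U uα)
...   | inj₁ (refl , refl) = refl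
...   | inj₂ (refl , refl) = sym (bottomOf-U uα)
α≡bottomOf (_ , _ , rise , _ , _ , _ , _) uγ | in-D dα = ⊥-elim (no-descent uγ dα rise)

γ≡topOf : ∀ {α β γ δ} → SeaRule (tet α β γ δ) → InD α → γ ≡ topOf α β
γ≡topOf {γ = γ} (_ , _ , rise , _ , γ-sea , _ , γ-D) dα with side γ
... | is-sea with γ-sea refl
...   | inj₁ (refl , refl) = refl
...   | inj₂ (refl , refl) = refl
γ≡topOf (_ , _ , _ , _ , _ , _ , γ-D) dα | in-D dγ with proj₂ (γ-D dγ)
...   | inj₁ (refl , refl) = refl
...   | inj₂ (refl , refl) = sym (topOf-D dγ)
γ≡topOf (_ , _ , rise , _ , _ , _ , _) dα | in-U uγ = ⊥-elim (no-descent uγ dα rise)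

CoupleUp CoupleDown : Tet A → Set
CoupleUp (tet α β γ δ) = (α ≡ sea → γ ≡ ↖ × δ ≡ ↗) × (α ≡ ↖ → γ ≡ ↖) × (α ≡ ↗ → δ ≡ ↗)
CoupleDown (tet α β γ δ) = (γ ≡ sea → α ≡ ↙ × β ≡ ↘) × (γ ≡ ↙ → α ≡ ↙) × (γ ≡ ↘ → β ≡ ↘)

coupleRule⇔ : ∀ t → CoupleRule t
  ⇔ ((proj₁ (proj₁ (α t)) ≡ true → CoupleUp (mapTet proj₂ t))
   × (proj₂ (proj₁ (γ t)) ≡ true → CoupleDown (mapTet proj₂ t)))
coupleRule⇔ (tet _ _ _ _) = mk⇔
  (λ (u₁ , u₂ , u₃ , d₁ , d₂ , d₃) → (λ F → u₁ F , u₂ F , u₃ F) , (λ G → d₁ G , d₂ G , d₃ G))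
  (λ (u , d) → (λ F → proj₁ (u F)) , (λ F → proj₁ (proj₂ (u F))) , (λ F → proj₂ (proj₂ (u F)))
              , (λ G → proj₁ (d G)) , (λ G → proj₁ (proj₂ (d G))) , (λ G → proj₂ (proj₂ (d G))))

coupleUp-above : ∀ w → CoupleUp (tetAbove w false)
coupleUp-above empty = (λ _ → refl , refl) , (λ ()) , (λ ())
coupleUp-above zeros = (λ ()) , (λ _ → refl) , (λ ())
coupleUp-above ones = (λ ()) , (λ ()) , (λ _ → refl)
coupleUp-above mixed = (λ ()) , (λ ()) , (λ ())

coupleDown-below : ∀ w → CoupleDown (tetBelow w false)
coupleDown-below empty = (λ _ → refl , refl) , (λ ()) , (λ ())
coupleDown-below zeros = (λ ()) , (λ _ → refl) , (λ ())
coupleDown-below ones = (λ ()) , (λ ()) , (λ _ → refl)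
coupleDown-below mixed = (λ ()) , (λ ()) , (λ ())

coupleUp-D : ∀ t → InD (α t) → CoupleUp t
coupleUp-D (tet _ _ _ _) d↙ = (λ ()) , (λ ()) , (λ ())
coupleUp-D (tet _ _ _ _) d↓ = (λ ()) , (λ ()) , (λ ())
coupleUp-D (tet _ _ _ _) d↘ = (λ ()) , (λ ()) , (λ ())

coupleDown-U : ∀ t → InU (γ t) → CoupleDown t
coupleDown-U (tet _ _ _ _) u↖ = (λ ()) , (λ ()) , (λ ())
coupleDown-U (tet _ _ _ _) u↑ = (λ ()) , (λ ()) , (λ ())
coupleDown-U (tet _ _ _ _) u↗ = (λ ()) , (λ ()) , (λ ())

forcedUp : ∀ w {α β γ δ} → α ≡ aboveSea w → SeaRule (tet α β γ δ) → CoupleUp (tet α β γ δ)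
         → γ ≡ aboveSea (snoc w false) × δ ≡ aboveSea (snoc w true)
forcedUp empty refl _ (α-sea , _) = α-sea refl
forcedUp zeros refl (_ , _ , _ , _ , _ , α-U , _) (_ , γ↖ , _) with γ↖ refl | proj₂ (α-U u↖)
... | refl | inj₁ (() , _)
... | refl | inj₂ (_ , δ↑) = refl , δ↑
forcedUp ones refl (_ , _ , _ , _ , _ , α-U , _) (_ , _ , δ↗) with δ↗ refl | proj₂ (α-U u↗)
... | refl | inj₁ (γ↑ , _) = γ↑ , refl
... | refl | inj₂ (_ , ())
forcedUp mixed refl (_ , _ , _ , _ , _ , α-U , _) _ with proj₂ (α-U u↑)
... | inj₁ ↑↑ = ↑↑
... | inj₂ ↑↑ = ↑↑

forcedDown : ∀ w {α β γ δ} → γ ≡ belowSea w → SeaRule (tet α β γ δ) → CoupleDown (tet α β γ δ)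
           → α ≡ belowSea (snoc w false) × β ≡ belowSea (snoc w true)
forcedDown empty refl _ (γ-sea , _) = γ-sea refl
forcedDown zeros refl (_ , _ , _ , _ , _ , _ , γ-D) (_ , α↙ , _) with α↙ refl | proj₂ (γ-D d↙)
... | refl | inj₁ (() , _)
... | refl | inj₂ (_ , β↓) = refl , β↓
forcedDown ones refl (_ , _ , _ , _ , _ , _ , γ-D) (_ , _ , β↘) with β↘ refl | proj₂ (γ-D d↘)
... | refl | inj₁ (α↓ , _) = α↓ , refl
... | refl | inj₂ (_ , ())
forcedDown mixed refl (_ , _ , _ , _ , _ , _ , γ-D) _ with proj₂ (γ-D d↓)
... | inj₁ ↓↓ = ↓↓
... | inj₂ ↓↓ = ↓↓

-- The configuration η★

sea★ : L → A
sea★ g = seaLevel (lamps g) (pos g)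

seaLevel-ext : ∀ {s s′} n → (∀ k → s k ≡ s′ k) → seaLevel s n ≡ seaLevel s′ n
seaLevel-ext (+ m) same = cong aboveSea (shape-ext _ _ m λ j _ → same (+ j))
seaLevel-ext -[1+ m ] same = cong belowSea (shape-ext _ _ (suc m) λ j _ → same -[1+ j ])

seaLevel-suc-[1+m] : ∀ s m → seaLevel s (ℤ.suc -[1+ m ]) ≡ belowSea (shape (λ j → s -[1+ j ]) m)
seaLevel-suc-[1+m] s zero = refl
seaLevel-suc-[1+m] s (suc m) = refl

sea★-tetrahedron-above : ∀ s m sp →
  tetrahedron sea★ (mkL s (+ m) sp) ≡ tetAbove (shape (λ j → s (+ j)) m) (s (+ m))
sea★-tetrahedron-above s m sp =
  tet-cong refl (cong aboveSea same) refl (cong aboveSea (cong₂ snoc same (toggle-here t)))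
  where
  t = mkL s (+ m) sp
  same : shape (λ j → lamps (toggle t) (+ j)) m ≡ shape (λ j → s (+ j)) m
  same = shape-ext _ _ m λ j j<m → toggle-elsewhere t (+ j) (ℕP.<⇒≢ j<m ∘ ℤP.+-injective)

sea★-tetrahedron-below : ∀ s m sp →
  tetrahedron sea★ (mkL s -[1+ m ] sp) ≡ tetBelow (shape (λ j → s -[1+ j ]) m) (s -[1+ m ])
sea★-tetrahedron-below s m sp =
  tet-cong refl (cong belowSea (cong₂ snoc same (toggle-here t)))
           (seaLevel-suc-[1+m] s m)
           (trans (seaLevel-suc-[1+m] (lamps (toggle t)) m) (cong belowSea same))
  where
  t = mkL s -[1+ m ] sp
  same : shape (λ j → lamps (toggle t) -[1+ j ]) m ≡ shape (λ j → s -[1+ j ]) m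
  same = shape-ext _ _ m λ j j<m → toggle-elsewhere t -[1+ j ] (ℕP.<⇒≢ j<m ∘ ℤP.-[1+-injective)

sea★-tetrahedron-clearAbove : ∀ s m sp → ClearAbove (mkL s (+ m) sp) →
  tetrahedron sea★ (mkL s (+ m) sp) ≡ tetAbove (shape (λ j → s (+ j)) m) false
sea★-tetrahedron-clearAbove s m sp clear =
  trans (sea★-tetrahedron-above s m sp) (cong (tetAbove _) (clear (+ m) ℤP.≤-refl))

sea★-tetrahedron-clearBelow : ∀ s m sp → ClearBelow (up (mkL s -[1+ m ] sp)) →
  tetrahedron sea★ (mkL s -[1+ m ] sp) ≡ tetBelow (shape (λ j → s -[1+ j ]) m) false
sea★-tetrahedron-clearBelow s m sp clear =
  trans (sea★-tetrahedron-below s m sp) (cong (tetBelow _) (clear -[1+ m ] (i<suc[i] _)))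

sea★-seaRule : ∀ g → SeaRule (tetrahedron sea★ g)
sea★-seaRule (mkL s (+ m) sp) = subst SeaRule (sym (sea★-tetrahedron-above s m sp)) (seaRule-above _ _)
sea★-seaRule (mkL s -[1+ m ] sp) = subst SeaRule (sym (sea★-tetrahedron-below s m sp)) (seaRule-below _ _)

sea★-coupleUp : ∀ g → ClearAbove g → CoupleUp (tetrahedron sea★ g)
sea★-coupleUp (mkL s (+ m) sp) clear =
  subst CoupleUp (sym (sea★-tetrahedron-clearAbove s m sp clear)) (coupleUp-above _)
sea★-coupleUp (mkL s -[1+ m ] sp) _ =
  subst CoupleUp (sym (sea★-tetrahedron-below s m sp)) (coupleUp-D (tetBelow w x) (belowSea-snoc w x))
  where
  w = shape (λ j → s -[1+ j ]) m
  x = s -[1+ m ]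

sea★-coupleDown : ∀ g → ClearBelow (up g) → CoupleDown (tetrahedron sea★ g)
sea★-coupleDown (mkL s (+ m) sp) _ =
  subst CoupleDown (sym (sea★-tetrahedron-above s m sp)) (coupleDown-U (tetAbove w x) (aboveSea-snoc w x))
  where
  w = shape (λ j → s (+ j)) m
  x = s (+ m)
sea★-coupleDown (mkL s -[1+ m ] sp) clear =
  subst CoupleDown (sym (sea★-tetrahedron-clearBelow s m sp clear)) (coupleDown-below _)

η★ : L → Val
η★ g = ((does (ClearAbove? g) , does (ClearBelow? g)) , sea★ g)

η★-respects : Respects η★
η★-respects g h g≈h@(same , refl) = cong₂ _,_
  (cong₂ _,_ (does-⇔ (mk⇔ (ClearAbove-≈ g h g≈h) (ClearAbove-≈ h g h≈g)) (ClearAbove? g) (ClearAbove? h))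
             (does-⇔ (mk⇔ (ClearBelow-≈ g h g≈h) (ClearBelow-≈ h g h≈g)) (ClearBelow? g) (ClearBelow? h)))
  (seaLevel-ext (pos g) same)
  where
  h≈g : h ≈L g
  h≈g = (λ k → sym (same k)) , refl

η★-leftRule : ∀ g → LeftRule (mapTet (λ x → proj₁ (proj₁ x)) (tetrahedron η★ g))
η★-leftRule g = Equivalence.from (leftRule⇔ _)
  ( does-⇔ (mk⇔ (ClearAbove-up⁻¹ g) (ClearAbove-up g)) (ClearAbove? (up g)) either
  , does-⇔ (mk⇔ (ClearAbove-up⁻¹ g ∘ ClearAbove-up∘untoggle g) (ClearAbove-up∘toggle g ∘ ClearAbove-up g))
           (ClearAbove? (up (toggle g))) either
  , dec-false (ClearAbove? g ×-dec ClearAbove? (toggle g))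
              (λ (clear , clear′) → ClearAbove-exclusive g clear clear′))
  where
  either = ClearAbove? g ⊎-dec ClearAbove? (toggle g)

η★-rightRule : ∀ g → RightRule (mapTet (λ x → proj₂ (proj₁ x)) (tetrahedron η★ g))
η★-rightRule g = Equivalence.from (rightRule⇔ _)
  ( does-⇔ (mk⇔ (ClearBelow-up⁻¹ g) ClearBelow-up⁻) (ClearBelow? g) either
  , does-⇔ (mk⇔ (ClearBelow-up⁻¹ g ∘ ClearBelow-untoggle g) (ClearBelow-toggle g ∘ ClearBelow-up⁻))
           (ClearBelow? (toggle g)) either
  , dec-false (ClearBelow? (up g) ×-dec ClearBelow? (up (toggle g)))
              (λ (clear , clear′) → ClearBelow-exclusive g clear clear′))
  where
  either = ClearBelow? (up g) ⊎-dec ClearBelow? (up (toggle g))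
  ClearBelow-up⁻ : ClearBelow (up g) ⊎ ClearBelow (up (toggle g)) → ClearBelow g
  ClearBelow-up⁻ (inj₁ clear) = ClearBelow-down g clear
  ClearBelow-up⁻ (inj₂ clear) = ClearBelow-untoggle g (ClearBelow-down (toggle g) clear)

η★-LRRule : ∀ g → LRRule (mapTet proj₁ (tetrahedron η★ g))
η★-LRRule g = (λ here → to (up g) (dark-up (from g here)))
          , (λ there → to g (dark-down (from (up g) there)))
  where
  to = λ g → Equivalence.from (both-true⇔ (ClearAbove? g) (ClearBelow? g))
  from = λ g → Equivalence.to (both-true⇔ (ClearAbove? g) (ClearBelow? g))
  dark-up : ClearAbove g × ClearBelow g → ClearAbove (up g) × ClearBelow (up g)
  dark-up (clear↑ , clear↓) = ClearAbove-up g (inj₁ clear↑) , ClearBelow-up g clear↓ (clear↑ _ ℤP.≤-refl)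
  dark-down : ClearAbove (up g) × ClearBelow (up g) → ClearAbove g × ClearBelow g
  dark-down (clear↑ , clear↓) =
    ClearAbove-down g clear↑ (clear↓ _ (i<suc[i] (pos g))) , ClearBelow-down g clear↓

η★∈Ω : InΩ η★
η★∈Ω = η★-respects , λ g → subst Admissible (sym (tetAt≡tetrahedron η★ η★-respects g))
  ( η★-leftRule g , η★-rightRule g , η★-LRRule g , sea★-seaRule g
  , Equivalence.from (coupleRule⇔ (tetrahedron η★ g))
      ( (λ F → sea★-coupleUp g (does⇒ (ClearAbove? g) F))
      , (λ G → sea★-coupleDown g (does⇒ (ClearBelow? (up g)) G))))

η★-𝟙 : η★ 𝟙 ≡ ((true , true) , sea)
η★-𝟙 = cong (_, sea)
  (Equivalence.from (both-true⇔ (ClearAbove? 𝟙) (ClearBelow? 𝟙)) ((λ _ _ → refl) , (λ _ _ → refl)))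

η★-lampFormula : LRFormula η★
η★-lampFormula g = does⇒ (ClearAbove? g) , dec-true (ClearAbove? g)
                 , does⇒ (ClearBelow? g) , dec-true (ClearBelow? g)

letters-above⇔ : ∀ s m sp c → WordU (mkL s +[1+ m ] sp) c ⇔ (∀ j → j ℕ.< suc m → s (+ j) ≡ c)
letters-above⇔ s m sp c = mk⇔
  (λ word j j<sm → word (+ j) (+≤+ ℕ.z≤n) (+<+ j<sm))
  (λ letters → λ { (+ j) _ (+<+ j<sm) → letters j j<sm })

letters-below⇔ : ∀ s m sp c → WordD (mkL s -[1+ m ] sp) c ⇔ (∀ j → j ℕ.< suc m → s -[1+ j ] ≡ c)
letters-below⇔ s m sp c = mk⇔
  (λ word j j<sm → word -[1+ j ] (-≤- (ℕP.≤-pred j<sm)) -<+)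
  (λ letters → λ { -[1+ j ] (-≤- j≤m) _ → letters j (ℕ.s≤s j≤m) ; (+ _) _ (+<+ ()) })

η★-seaFormula : SeaFormula η★
η★-seaFormula (mkL s (+ zero) sp) =
  (λ { (+<+ ()) }) , (λ { (+<+ ()) }) , (λ { (+<+ ()) }) , (λ _ → refl)
  , (λ { (+<+ ()) }) , (λ { (+<+ ()) }) , (λ { (+<+ ()) })
η★-seaFormula (mkL s +[1+ m ] sp) =
    (λ _ word → cong aboveSea (shape-constant f m false (to false word)))
  , (λ _ word → cong aboveSea (shape-constant f m true (to true word)))
  , (λ _ ¬zeros ¬ones → cong aboveSea (shape-mixed f m λ
       { false letters → ¬zeros (from false letters) ; true letters → ¬ones (from true letters) }))
  , (λ ())
  , (λ { (+<+ ()) }) , (λ { (+<+ ()) }) , (λ { (+<+ ()) })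
  where
  f = λ j → s (+ j)
  to = λ c → Equivalence.to (letters-above⇔ s m sp c)
  from = λ c → Equivalence.from (letters-above⇔ s m sp c)
η★-seaFormula (mkL s -[1+ m ] sp) =
    (λ ()) , (λ ()) , (λ ()) , (λ ())
  , (λ _ word → cong belowSea (shape-constant f m false (to false word)))
  , (λ _ word → cong belowSea (shape-constant f m true (to true word)))
  , (λ _ ¬zeros ¬ones → cong belowSea (shape-mixed f m λ
       { false letters → ¬zeros (from false letters) ; true letters → ¬ones (from true letters) }))
  where
  f = λ j → s -[1+ j ]
  to = λ c → Equivalence.to (letters-below⇔ s m sp c)
  from = λ c → Equivalence.from (letters-below⇔ s m sp c)

-- Uniqueness

module Uniqueness (η : L → Val) (η∈Ω : InΩ η) (η𝟙 : η 𝟙 ≡ ((true , true) , sea)) where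

  respects : Respects η
  respects = proj₁ η∈Ω

  admissible : ∀ g → Admissible (tetrahedron η g)
  admissible g = subst Admissible (tetAt≡tetrahedron η respects g) (proj₂ η∈Ω g)

  F G : L → Bool
  F g = proj₁ (proj₁ (η g))
  G g = proj₂ (proj₁ (η g))

  F-≈ : ∀ g h → g ≈L h → F g ≡ F h
  F-≈ g h g≈h = cong (λ x → proj₁ (proj₁ x)) (respects g h g≈h)

  G-≈ : ∀ g h → g ≈L h → G g ≡ G h
  G-≈ g h g≈h = cong (λ x → proj₂ (proj₁ x)) (respects g h g≈h)

  left-rule : ∀ g → F (up g) ≡ F g ∨ F (toggle g) × F (up (toggle g)) ≡ F g ∨ F (toggle g)
                × F g ∧ F (toggle g) ≡ false
  left-rule g =
    Equivalence.to (leftRule⇔ (mapTet (λ x → proj₁ (proj₁ x)) (tetrahedron η g))) (proj₁ (admissible g))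

  right-rule : ∀ g → G g ≡ G (up g) ∨ G (up (toggle g)) × G (toggle g) ≡ G (up g) ∨ G (up (toggle g))
                × G (up g) ∧ G (up (toggle g)) ≡ false
  right-rule g =
    Equivalence.to (rightRule⇔ (mapTet (λ x → proj₂ (proj₁ x)) (tetrahedron η g))) (proj₁ (proj₂ (admissible g)))

  F-up : ∀ g → F (up g) ≡ F g ∨ F (toggle g)
  F-up g = proj₁ (left-rule g)

  F-exclusive : ∀ g → F g ∧ F (toggle g) ≡ false
  F-exclusive g = proj₂ (proj₂ (left-rule g))

  G-down : ∀ g → G g ≡ G (up g) ∨ G (up (toggle g))
  G-down g = proj₁ (right-rule g)

  G-exclusive : ∀ g → G (up g) ∧ G (up (toggle g)) ≡ false
  G-exclusive g = proj₂ (proj₂ (right-rule g))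

  LR-rule : ∀ g → LRRule (mapTet proj₁ (tetrahedron η g))
  LR-rule g = proj₁ (proj₂ (proj₂ (admissible g)))

  unlit-both-true : ∀ n → proj₁ (η (unlit n)) ≡ (true , true)
  unlit-both-true (+ zero) = cong proj₁ η𝟙
  unlit-both-true +[1+ m ] = proj₁ (LR-rule (unlit (+ m))) (unlit-both-true (+ m))
  unlit-both-true -[1+ zero ] = proj₂ (LR-rule (unlit -[1+ 0 ])) (cong proj₁ η𝟙)
  unlit-both-true -[1+ suc m ] = proj₂ (LR-rule (unlit -[1+ suc m ])) (unlit-both-true -[1+ m ])

  all-off⇒both-true : ∀ g → ClearAbove g → ClearBelow g → proj₁ (η g) ≡ (true , true)
  all-off⇒both-true g clear↑ clear↓ =
    trans (cong proj₁ (respects _ _ (all-off≈unlit g clear↑ clear↓))) (unlit-both-true (pos g))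

  ClearAbove⇒F : ∀ g → ClearAbove g → F g ≡ true
  ClearAbove⇒F g = go (proj₁ (finite-below g)) g (proj₂ (finite-below g))
    where
    go : ∀ d g → ClearBelowFrom d g → ClearAbove g → F g ≡ true
    go zero g clear↓ clear↑ = cong proj₁ (all-off⇒both-true g clear↑ (ClearBelowFrom-zero g clear↓))
    go (suc d) g clear↓ clear↑ =
      trans (F-≈ g (up h) (id≈up∘down g))
            (trans (F-up h) (either (ClearAbove-up⁻¹ h (ClearAbove-≈ g (up h) (id≈up∘down g) clear↑))))
      where
      h = down g
      either : ClearAbove h ⊎ ClearAbove (toggle h) → F h ∨ F (toggle h) ≡ true
      either (inj₁ clear) = cong (_∨ F (toggle h)) (go d h (ClearBelowFrom-down d g clear↓) clear)
      either (inj₂ clear) =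
        trans (cong (F h ∨_) (go d (toggle h) (ClearBelowFrom-toggle∘down d g clear↓) clear)) (∨-zeroʳ (F h))

  F⇒ClearAbove : ∀ g → F g ≡ true → ClearAbove g
  F⇒ClearAbove g = go (proj₁ (finite-above g)) g (proj₂ (finite-above g))
    where
    go : ∀ d g → ClearAboveFrom d g → F g ≡ true → ClearAbove g
    go zero g clear _ = ClearAboveFrom-zero g clear
    go (suc d) g clear Fg
      with ClearAbove-up⁻¹ g
             (go d (up g) (ClearAboveFrom-up d g clear) (trans (F-up g) (cong (_∨ F (toggle g)) Fg)))
    ... | inj₁ clear↑ = clear↑
    ... | inj₂ clear↑ =
      ⊥-elim (false≢true (trans (sym (F-exclusive g)) (cong₂ _∧_ Fg (ClearAbove⇒F (toggle g) clear↑))))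

  ClearBelow⇒G : ∀ g → ClearBelow g → G g ≡ true
  ClearBelow⇒G g = go (proj₁ (finite-above g)) g (proj₂ (finite-above g))
    where
    go : ∀ d g → ClearAboveFrom d g → ClearBelow g → G g ≡ true
    go zero g clear↑ clear↓ = cong proj₂ (all-off⇒both-true g (ClearAboveFrom-zero g clear↑) clear↓)
    go (suc d) g clear↑ clear↓ = trans (G-down g) (either (ClearBelow-up⁻¹ g clear↓))
      where
      either : ClearBelow (up g) ⊎ ClearBelow (up (toggle g)) → G (up g) ∨ G (up (toggle g)) ≡ true
      either (inj₁ clear) = cong (_∨ G (up (toggle g))) (go d (up g) (ClearAboveFrom-up d g clear↑) clear)
      either (inj₂ clear) =
        trans (cong (G (up g) ∨_) (go d (up (toggle g)) (ClearAboveFrom-up∘toggle d g clear↑) clear))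
              (∨-zeroʳ (G (up g)))

  G⇒ClearBelow : ∀ g → G g ≡ true → ClearBelow g
  G⇒ClearBelow g = go (proj₁ (finite-below g)) g (proj₂ (finite-below g))
    where
    go : ∀ d g → ClearBelowFrom d g → G g ≡ true → ClearBelow g
    go zero g clear _ = ClearBelowFrom-zero g clear
    go (suc d) g clear Gg = step (ClearBelow-up⁻¹ h (go d h (ClearBelowFrom-down d g clear) Gh))
      where
      h = down g
      G-up-h : G (up h) ≡ true
      G-up-h = trans (G-≈ (up h) g (up∘down≈id g)) Gg
      Gh : G h ≡ true
      Gh = trans (G-down h) (cong (_∨ G (up (toggle h))) G-up-h)
      step : ClearBelow (up h) ⊎ ClearBelow (up (toggle h)) → ClearBelow g
      step (inj₁ clear↓) = ClearBelow-≈ (up h) g (up∘down≈id g) clear↓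
      step (inj₂ clear↓) = ⊥-elim (false≢true (trans (sym (G-exclusive h))
                                     (cong₂ _∧_ G-up-h (ClearBelow⇒G (up (toggle h)) clear↓))))

  lamps-agree : ∀ g → proj₁ (η g) ≡ proj₁ (η★ g)
  lamps-agree g = cong₂ _,_ (≡does (ClearAbove? g) (F⇒ClearAbove g) (ClearAbove⇒F g))
                            (≡does (ClearBelow? g) (G⇒ClearBelow g) (ClearBelow⇒G g))

  σ : L → A
  σ g = proj₂ (η g)

  Agree : L → Set
  Agree g = σ g ≡ sea★ g

  Agree-≈ : ∀ g h → g ≈L h → Agree g → Agree h
  Agree-≈ g h g≈h agree =
    trans (cong proj₂ (sym (respects g h g≈h))) (trans agree (cong proj₂ (η★-respects g h g≈h)))

  seaRule : ∀ g → SeaRule (tetrahedron σ g)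
  seaRule g = proj₁ (proj₂ (proj₂ (proj₂ (admissible g))))

  coupleUp : ∀ g → ClearAbove g → CoupleUp (tetrahedron σ g)
  coupleUp g clear =
    proj₁ (Equivalence.to (coupleRule⇔ (tetrahedron η g)) (proj₂ (proj₂ (proj₂ (proj₂ (admissible g))))))
          (ClearAbove⇒F g clear)

  coupleDown : ∀ g → ClearBelow (up g) → CoupleDown (tetrahedron σ g)
  coupleDown g clear =
    proj₂ (Equivalence.to (coupleRule⇔ (tetrahedron η g)) (proj₂ (proj₂ (proj₂ (proj₂ (admissible g))))))
          (ClearBelow⇒G (up g) clear)

  agree-up : ∀ g → 0ℤ ≤ pos g → ClearAbove g → Agree g → Agree (up g) × Agree (up (toggle g))
  agree-up t@(mkL s (+ m) sp) _ clear agree =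
    let γ≡ , δ≡ = forcedUp w (trans agree (cong α tetrahedron≡)) (seaRule t) (coupleUp t clear)
    in trans γ≡ (sym (cong γ tetrahedron≡)) , trans δ≡ (sym (cong δ tetrahedron≡))
    where
    w = shape (λ j → s (+ j)) m
    tetrahedron≡ = sea★-tetrahedron-clearAbove s m sp clear

  agree-down : ∀ g → pos g < 0ℤ → ClearBelow (up g) → Agree (up g) → Agree g × Agree (toggle g)
  agree-down t@(mkL s -[1+ m ] sp) _ clear agree =
    let α≡ , β≡ = forcedDown w (trans agree (cong γ tetrahedron≡)) (seaRule t) (coupleDown t clear)
    in trans α≡ (sym (cong α tetrahedron≡)) , trans β≡ (sym (cong β tetrahedron≡))
    where
    w = shape (λ j → s -[1+ j ]) m
    tetrahedron≡ = sea★-tetrahedron-clearBelow s m sp clear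
  agree-down (mkL _ (+ _) _) (+<+ ()) _ _

  agree-from-up : ∀ g → 0ℤ ≤ pos g → Agree (up g) → Agree (up (toggle g)) → Agree g
  agree-from-up g@(mkL s (+ m) sp) _ agree₁ agree₂ = begin
    σ g                                          ≡⟨ α≡bottomOf (seaRule g) (subst InU (sym agree₁) top) ⟩
    bottomOf (σ (up g)) (σ (up (toggle g)))      ≡⟨ cong₂ bottomOf agree₁ agree₂ ⟩
    bottomOf (sea★ (up g)) (sea★ (up (toggle g))) ≡⟨ sym (α≡bottomOf (sea★-seaRule g) top) ⟩
    sea★ g                                       ∎
    where
    open ≡-Reasoning
    top : InU (sea★ (up g))
    top = aboveSea-snoc (shape (λ j → s (+ j)) m) (s (+ m))

  agree-from-down : ∀ g → pos g < 0ℤ → Agree g → Agree (toggle g) → Agree (up g)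
  agree-from-down g@(mkL s -[1+ m ] sp) _ agree₁ agree₂ = begin
    σ (up g)                          ≡⟨ γ≡topOf (seaRule g) (subst InD (sym agree₁) bottom) ⟩
    topOf (σ g) (σ (toggle g))        ≡⟨ cong₂ topOf agree₁ agree₂ ⟩
    topOf (sea★ g) (sea★ (toggle g))  ≡⟨ sym (γ≡topOf (sea★-seaRule g) bottom) ⟩
    sea★ (up g)                       ∎
    where
    open ≡-Reasoning
    bottom : InD (sea★ g)
    bottom = belowSea-snoc (shape (λ j → s -[1+ j ]) m) (s -[1+ m ])
  agree-from-down (mkL _ (+ _) _) (+<+ ()) _ _

  module FromSeaUpwards (t₀ : L) (level₀ : pos t₀ ≡ 0ℤ) (clear₀ : ClearAbove t₀) (agree₀ : Agree t₀) where

    SameBelowSea : L → Set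
    SameBelowSea t = ∀ k → k < 0ℤ → lamps t k ≡ lamps t₀ k

    toggle-SameBelowSea : ∀ t → 0ℤ ≤ pos t → SameBelowSea t → SameBelowSea (toggle t)
    toggle-SameBelowSea t nonneg same k k<0 = trans (toggle-below t k (ℤP.<-≤-trans k<0 nonneg)) (same k k<0)

    corner : ∀ m s sp → ClearAbove (mkL s (+ m) sp) → SameBelowSea (mkL s (+ m) sp) → Agree (mkL s (+ m) sp)
    corner zero s sp clear same = Agree-≈ t₀ (mkL s (+ 0) sp) (match , level₀) agree₀
      where
      match : ∀ k → lamps t₀ k ≡ s k
      match (+ j) =
        trans (clear₀ (+ j) (subst (_≤ + j) (sym level₀) (+≤+ ℕ.z≤n))) (sym (clear (+ j) (+≤+ ℕ.z≤n)))
      match -[1+ j ] = sym (same -[1+ j ] -<+)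
    corner (suc m) s sp clear same = step (ClearAbove-up⁻¹ h clear)
      where
      h = mkL s (+ m) sp
      step : ClearAbove h ⊎ ClearAbove (toggle h) → Agree (up h)
      step (inj₁ clear′) = proj₁ (agree-up h (+≤+ ℕ.z≤n) clear′ (corner m s sp clear′ same))
      step (inj₂ clear′) =
        Agree-≈ (up (toggle (toggle h))) (up h) (up-≈ (toggle (toggle h)) h (toggle∘toggle≈id h))
          (proj₂ (agree-up (toggle h) (+≤+ ℕ.z≤n) clear′
                   (corner m (lamps (toggle h)) (supp (toggle h)) clear′
                           (toggle-SameBelowSea h (+≤+ ℕ.z≤n) same))))

    agree-above : ∀ t → 0ℤ ≤ pos t → SameBelowSea t → Agree t
    agree-above t nonneg same = fill (proj₁ (finite-above t)) t nonneg same (proj₂ (finite-above t))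
      where
      fill : ∀ d t → 0ℤ ≤ pos t → SameBelowSea t → ClearAboveFrom d t → Agree t
      fill zero t@(mkL s (+ m) sp) _ same clear = corner m s sp (ClearAboveFrom-zero t clear) same
      fill (suc d) t nonneg same clear =
        agree-from-up t nonneg
          (fill d (up t) nonneg↑ same (ClearAboveFrom-up d t clear))
          (fill d (up (toggle t)) nonneg↑ (toggle-SameBelowSea t nonneg same)
                (ClearAboveFrom-up∘toggle d t clear))
        where
        nonneg↑ = ℤP.≤-trans nonneg (ℤP.i≤suc[i] (pos t))

  module FromSeaDownwards (t₀ : L) (level₀ : pos t₀ ≡ 0ℤ) (clear₀ : ClearBelow t₀) (agree₀ : Agree t₀) where

    SameAboveSea : L → Set
    SameAboveSea t = ∀ k → 0ℤ ≤ k → lamps t k ≡ lamps t₀ k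

    toggle-SameAboveSea : ∀ t → pos t < 0ℤ → SameAboveSea t → SameAboveSea (toggle t)
    toggle-SameAboveSea t neg same k 0≤k = trans (toggle-above t k (ℤP.<-≤-trans neg 0≤k)) (same k 0≤k)

    at-sea : ∀ s sp → ClearBelow (mkL s 0ℤ sp) → SameAboveSea (mkL s 0ℤ sp) → Agree (mkL s 0ℤ sp)
    at-sea s sp clear same = Agree-≈ t₀ (mkL s 0ℤ sp) (match , level₀) agree₀
      where
      match : ∀ k → lamps t₀ k ≡ s k
      match (+ j) = sym (same (+ j) (+≤+ ℕ.z≤n))
      match -[1+ j ] =
        trans (clear₀ -[1+ j ] (subst (-[1+ j ] <_) (sym level₀) -<+)) (sym (clear -[1+ j ] -<+))

    corner : ∀ m s sp → ClearBelow (mkL s -[1+ m ] sp) → SameAboveSea (mkL s -[1+ m ] sp)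
           → Agree (mkL s -[1+ m ] sp)
    corner-up : ∀ m s sp → ClearBelow (up (mkL s -[1+ m ] sp)) → SameAboveSea (mkL s -[1+ m ] sp)
              → Agree (up (mkL s -[1+ m ] sp))
    corner-up zero = at-sea
    corner-up (suc m) = corner m
    corner m s sp clear same = step (ClearBelow-up⁻¹ t clear)
      where
      t = mkL s -[1+ m ] sp
      step : ClearBelow (up t) ⊎ ClearBelow (up (toggle t)) → Agree t
      step (inj₁ clear↑) = proj₁ (agree-down t -<+ clear↑ (corner-up m s sp clear↑ same))
      step (inj₂ clear↑) =
        Agree-≈ (toggle (toggle t)) t (toggle∘toggle≈id t)
          (proj₂ (agree-down (toggle t) -<+ clear↑
                   (corner-up m (lamps (toggle t)) (supp (toggle t)) clear↑ (toggle-SameAboveSea t -<+ same))))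

    agree-below : ∀ t → pos t ≤ 0ℤ → SameAboveSea t → Agree t
    agree-below t nonpos same = fill (proj₁ (finite-below t)) t nonpos same (proj₂ (finite-below t))
      where
      fill : ∀ d t → pos t ≤ 0ℤ → SameAboveSea t → ClearBelowFrom d t → Agree t
      fill zero t@(mkL s (+ zero) sp) _ same clear = at-sea s sp (ClearBelowFrom-zero t clear) same
      fill zero t@(mkL s -[1+ m ] sp) _ same clear = corner m s sp (ClearBelowFrom-zero t clear) same
      fill zero (mkL _ +[1+ _ ] _) (+≤+ ()) _ _
      fill (suc d) t nonpos same clear =
        Agree-≈ (up (down t)) t (up∘down≈id t)
          (agree-from-down (down t) neg
            (fill d (down t) (ℤP.<⇒≤ neg) same (ClearBelowFrom-down d t clear))
            (fill d (toggle (down t)) (ℤP.<⇒≤ neg) (toggle-SameAboveSea (down t) neg same)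
                  (ClearBelowFrom-toggle∘down d t clear)))
        where
        neg : ℤ.pred (pos t) < 0ℤ
        neg = ℤP.<-≤-trans (ℤP.i≤pred[j]⇒i<j ℤP.≤-refl) nonpos

  -- negativePart g is reached from 𝟙 by the downward pass, and it anchors the upward pass to g.
  agree-above-sea : ∀ g → 0ℤ ≤ pos g → Agree g
  agree-above-sea g nonneg =
    FromSeaUpwards.agree-above (negativePart g) refl (λ { (+ _) _ → refl }) agree⁻ g nonneg
                               (λ { -[1+ _ ] _ → refl ; (+ _) (+<+ ()) })
    where
    agree⁻ : Agree (negativePart g)
    agree⁻ = FromSeaDownwards.agree-below 𝟙 refl (λ _ _ → refl) (cong proj₂ η𝟙)
                                          (negativePart g) ℤP.≤-refl (λ { (+ _) _ → refl })

  agree : ∀ g → Agree g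
  agree g with ℤP.≤-total 0ℤ (pos g)
  ... | inj₁ nonneg = agree-above-sea g nonneg
  ... | inj₂ nonpos =
    FromSeaDownwards.agree-below (nonnegativePart g) refl (λ { -[1+ _ ] _ → refl ; (+ _) (+<+ ()) })
                                 (agree-above-sea (nonnegativePart g) ℤP.≤-refl) g nonpos (λ { (+ _) _ → refl })

  η≡η★ : ∀ g → η g ≡ η★ g
  η≡η★ g = cong₂ _,_ (lamps-agree g) (agree g)

lemma6p9 : Σ (L → Val) λ η →
    InΩ η
  × η 𝟙 ≡ ((true , true) , sea)
  × (∀ η′ → InΩ η′ → η′ 𝟙 ≡ ((true , true) , sea) → ∀ g → η′ g ≡ η g)
  × LRFormula η
  × SeaFormula η
lemma6p9 = η★ , η★∈Ω , η★-𝟙 , (λ η η∈Ω η𝟙 → Uniqueness.η≡η★ η η∈Ω η𝟙) , η★-lampFormula , η★-seaFormula
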